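{- Let $k\ge 1$ and $a\ge 0$ be integers and let $Z$ be a $(k,a)$-narrow set in a graph $G$. Then (a) the $G$-diameter of any connected subgraph of $G[Z]$ is at most $2ak+k-1$; and (b) if $\varphi$ is any coloring of a subgraph $H$ of $G$ with $Z\subseteq V(H)$, and the restriction of $\varphi$ to $H-Z$ has $G$-diameter at most $\ell$, then $\varphi$ has $G$-diameter at most $k(2a+2\ell+3)$.
   Context: A set $Z$ of vertices of $G$ is $(k,a)$-narrow in $G$ if there is a set $D\subseteq V(G)$ of size at most $k$ such that every vertex of $Z$ is at distance at most $a$ in $G$ from $D$. Colorings are not necessarily proper. A subgraph is monochromatic if all its vertices have the same color. The $G$-diameter of a subgraph is the maximum distance in $G$ between its vertices; the $G$-diameter of a coloring of a subgraph $F$ of $G$ is the maximum $G$-diameter of a monochromatic connected subgraph of $F$. -}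

module Defs where

open import Data.Nat using (ℕ; zero; suc; _≤_)
open import Data.Fin using (Fin)
open import Data.Fin.Subset using (Subset; _∈_; _∉_; _⊆_; _∩_; ∁; ∣_∣)
open import Data.Product using (Σ; ∃; _×_; _,_)
open import Relation.Nullary using (¬_)
open import Relation.Binary.PropositionalEquality using (_≡_)

record Graph (n : ℕ) : Set₁ where
  field
    Adj    : Fin n → Fin n → Set
    sym    : ∀ {u v} → Adj u v → Adj v u
    irrefl : ∀ {u} → ¬ Adj u u
open Graph public

data Walk {n : ℕ} (R : Fin n → Fin n → Set) : Fin n → Fin n → ℕ → Set where
  here : ∀ {u} → Walk R u u 0
  step : ∀ {u w v m} → R u w → Walk R w v m → Walk R u v (suc m)

DistLe : ∀ {n} → Graph n → Fin n → Fin n → ℕ → Set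
DistLe G u v d = Σ ℕ λ m → m ≤ d × Walk (Adj G) u v m

Narrow : ∀ {n} → Graph n → ℕ → ℕ → Subset n → Set
Narrow {n} G k a Z =
  Σ (Subset n) λ D → ∣ D ∣ ≤ k ×
    (∀ z → z ∈ Z → Σ (Fin n) λ x → x ∈ D × DistLe G z x a)

record Subgraph {n : ℕ} (G : Graph n) : Set₁ where
  field
    vs    : Subset n
    es    : Fin n → Fin n → Set
    es⊆E  : ∀ {u v} → es u v → Adj G u v
    es-l  : ∀ {u v} → es u v → u ∈ vs
    es-r  : ∀ {u v} → es u v → v ∈ vs
    es-sym : ∀ {u v} → es u v → es v u
open Subgraph public

SubOf : ∀ {n} {G : Graph n} → Subgraph G → Subgraph G → Set
SubOf F' F = (vs F' ⊆ vs F) × (∀ {u v} → es F' u v → es F u v)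

-- F is a subgraph of the induced subgraph G[Z].
InInduced : ∀ {n} {G : Graph n} → Subgraph G → Subset n → Set
InInduced F Z = vs F ⊆ Z

Connected : ∀ {n} {G : Graph n} → Subgraph G → Set
Connected F = ∀ u v → u ∈ vs F → v ∈ vs F → Σ ℕ λ m → Walk (es F) u v m

GDiamLe : ∀ {n} (G : Graph n) → Subgraph G → ℕ → Set
GDiamLe G F d = ∀ u v → u ∈ vs F → v ∈ vs F → DistLe G u v d

Monochromatic : ∀ {n} {G : Graph n} {C : Set} → (Fin n → C) → Subgraph G → Set
Monochromatic φ F = ∀ u v → u ∈ vs F → v ∈ vs F → φ u ≡ φ v

ColDiamLe : ∀ {n} (G : Graph n) {C : Set} → (Fin n → C) → Subgraph G → ℕ → Set₁
ColDiamLe G φ F d =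
  ∀ (F' : Subgraph G) → SubOf F' F → Connected F' → Monochromatic φ F' → GDiamLe G F' d

_minus_ : ∀ {n} {G : Graph n} → Subgraph G → Subset n → Subgraph G
_minus_ {G = G} H Z = record
  { vs = vs H ∩ ∁ Z
  ; es = λ u v → es H u v × u ∉ Z × v ∉ Z
  ; es⊆E = λ { (e , _ , _) → es⊆E H e }
  ; es-l = λ { (e , p , _) → x∈p∖q H Z (es-l H e) p }
  ; es-r = λ { (e , _ , q) → x∈p∖q H Z (es-r H e) q }
  ; es-sym = λ { (e , p , q) → es-sym H e , q , p }
  }
  where
  open import Data.Fin.Subset.Properties using (x∈p∩q⁺; x∉p⇒x∈∁p)
  x∈p∖q : ∀ {n} {G : Graph n} (H : Subgraph G) (Z : Subset n) {x} → x ∈ vs H → x ∉ Z → x ∈ vs H ∩ ∁ Z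
  x∈p∖q H Z a b = x∈p∩q⁺ (a , x∉p⇒x∈∁p b)

{-# OPTIONS --safe #-}
-- Give every vertex of Z an anchor in D at distance at most a; vertices with the same anchor are
-- within 2a of each other. Along a sequence of Z-vertices whose consecutive members are within g,
-- jump from the first vertex (cost 2a) to the last one sharing its anchor, take one step (cost g),
-- and continue along a remainder that never meets that anchor again. Each of the at most k anchors
-- is paid for once, so the ends of the sequence are within k(2a + g) − g.
-- For (a) the sequence is a walk of G[Z] itself and g = 1. For (b) it is the sequence of Z-vertices
-- of a walk in a monochromatic connected subgraph of H: between two consecutive ones the walk runs
-- through a monochromatic connected subgraph of H − Z, so g = ℓ + 2, and the stretches before the
-- first and after the last Z-vertex add at most ℓ + 1 each.
module Submission where

open import Defs
open import Data.Nat using (ℕ; zero; suc; z≤n; NonZero; _≤_; _+_; _*_; _∸_)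
open import Data.Nat.Properties
  using ( ≤-refl; ≤-reflexive; ≤-trans; ≤-pred; n≤1+n; m≤m+n; m≤n+m; m≤n*m; m+n≤o⇒m≤o∸n
        ; +-comm; +-assoc; +-mono-≤; +-monoˡ-≤; +-monoʳ-≤; module ≤-Reasoning)
open import Data.Nat.Tactic.RingSolver using (solve-∀)
open import Data.Fin using (Fin; _≟_)
open import Data.Fin.Subset using (Subset; _⊆_; _∈_; _∉_; _∩_; ∁; ∣_∣; ⊥; ⁅_⁆; _∪_; _-_)
open import Data.Fin.Subset.Properties
  using ( _∈?_; x∈p∩q⁺; x∉p⇒x∈∁p; x∈p∪q⁻; x∈p∪q⁺; x∈⁅x⁆; x∈⁅y⁆⇒x≡y; ∉⊥
        ; x∈p∧x≢y⇒x∈p-y; x∈p⇒∣p-x∣<∣p∣)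
open import Data.Product using (Σ; ∃; _×_; _,_; proj₁; proj₂)
open import Data.Sum using (_⊎_; inj₁; inj₂)
open import Data.Empty using (⊥-elim)
open import Data.List using (List; []; _∷_; _++_)
open import Data.List.Relation.Unary.All as All using (All; []; _∷_)
open import Data.List.Relation.Unary.All.Properties using (++⁻ʳ)
open import Data.List.Relation.Unary.Any using (here; there)
open import Data.List.Membership.Propositional using () renaming (_∈_ to _∈ₗ_)
open import Function using (_∘_)
open import Relation.Nullary using (¬_; yes; no)
open import Relation.Unary using (Decidable)
open import Relation.Binary.PropositionalEquality using (_≡_; _≢_; refl; cong; subst)
  renaming (sym to ≡-sym)

module _ {n : ℕ} {R : Fin n → Fin n → Set} where

  vertices : ∀ {u v m} → Walk R u v m → List (Fin n)
  vertices (here {u}) = u ∷ []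
  vertices (step {u} _ W) = u ∷ vertices W

  laterVertices : ∀ {u v m} → Walk R u v m → List (Fin n)
  laterVertices here = []
  laterVertices (step _ W) = vertices W

  _++ʷ_ : ∀ {u w v m₁ m₂} → Walk R u w m₁ → Walk R w v m₂ → Walk R u v (m₁ + m₂)
  here ++ʷ W = W
  step e W₁ ++ʷ W = step e (W₁ ++ʷ W)

  _▷_ : ∀ {u w v m} → Walk R u w m → R w v → Walk R u v (suc m)
  here ▷ e = step e here
  step e′ W ▷ e = step e′ (W ▷ e)

  reverse : (∀ {x y} → R x y → R y x) → ∀ {u v m} → Walk R u v m → Walk R v u m
  reverse sym here = here
  reverse sym (step e W) = reverse sym W ▷ sym e

  start∈vertices : ∀ {u v m} (W : Walk R u v m) → u ∈ₗ vertices W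
  start∈vertices here = here refl
  start∈vertices (step _ _) = here refl

  end∈vertices : ∀ {u v m} (W : Walk R u v m) → v ∈ₗ vertices W
  end∈vertices here = here refl
  end∈vertices (step _ W) = there (end∈vertices W)

  All-start : ∀ {P : Fin n → Set} {u v m} (W : Walk R u v m) → All P (vertices W) → P u
  All-start here (p ∷ _) = p
  All-start (step _ _) (p ∷ _) = p

  All-vertices : ∀ {P : Fin n → Set} → (∀ {x y} → R x y → P y) →
                 ∀ {u v m} → P u → (W : Walk R u v m) → All P (vertices W)
  All-vertices target p here = p ∷ []
  All-vertices target p (step e W) = p ∷ All-vertices target (target e) W

  walkTo : ∀ {P : Fin n → Set} {u v m} (W : Walk R u v m) → All P (vertices W) →
           ∀ {x} → x ∈ₗ vertices W → ∃ λ m′ → Walk (λ y z → P y × P z × R y z) u x m′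
  walkTo here _ (here refl) = 0 , here
  walkTo (step _ _) _ (here refl) = 0 , here
  walkTo (step e W) (p ∷ ps) (there x∈W) with walkTo W ps x∈W
  ... | m′ , W′ = suc m′ , step (p , All-start W ps , e) W′

  record LastVisit (P : Fin n → Set) {u v m} (W : Walk R u v m) : Set where
    field
      {from}     : Fin n
      {length}   : ℕ
      prefix     : List (Fin n)
      suffix     : Walk R from v length
      vertices-≡ : vertices W ≡ prefix ++ vertices suffix
      visits     : P from
      avoids     : All (¬_ ∘ P) (laterVertices suffix)

  open LastVisit

  lastVisit : ∀ {P : Fin n → Set} → Decidable P → ∀ {u v m} (W : Walk R u v m) →
              All (¬_ ∘ P) (vertices W) ⊎ LastVisit P W
  lastVisit P? (here {u}) with P? u
  ... | yes p = inj₂ record { prefix = [] ; suffix = here ; vertices-≡ = refl ; visits = p ; avoids = [] }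
  ... | no ¬p = inj₁ (¬p ∷ [])
  lastVisit P? (step {u} e W) with lastVisit P? W
  ... | inj₂ lv = inj₂ record
    { prefix = u ∷ prefix lv ; suffix = suffix lv ; vertices-≡ = cong (u ∷_) (vertices-≡ lv)
    ; visits = visits lv ; avoids = avoids lv }
  ... | inj₁ none with P? u
  ...   | yes p = inj₂ record
    { prefix = [] ; suffix = step e W ; vertices-≡ = refl ; visits = p ; avoids = none }
  ...   | no ¬p = inj₁ (¬p ∷ none)

  All-suffix : ∀ {P Q : Fin n → Set} {u v m} {W : Walk R u v m} (lv : LastVisit P W) →
               All Q (vertices W) → All Q (vertices (suffix lv))
  All-suffix lv = ++⁻ʳ (prefix lv) ∘ subst (All _) (vertices-≡ lv)

open LastVisit

module _ {n : ℕ} (G : Graph n) where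

  DistLe-refl : ∀ {u d} → DistLe G u u d
  DistLe-refl = 0 , z≤n , here

  Adj⇒DistLe : ∀ {u v} → Adj G u v → DistLe G u v 1
  Adj⇒DistLe e = 1 , ≤-refl , step e here

  DistLe-trans : ∀ {u w v d₁ d₂} → DistLe G u w d₁ → DistLe G w v d₂ → DistLe G u v (d₁ + d₂)
  DistLe-trans (m₁ , m₁≤ , W₁) (m₂ , m₂≤ , W₂) = m₁ + m₂ , +-mono-≤ m₁≤ m₂≤ , W₁ ++ʷ W₂

  DistLe-sym : ∀ {u v d} → DistLe G u v d → DistLe G v u d
  DistLe-sym (m , m≤ , W) = m , m≤ , reverse (sym G) W

  DistLe-mono : ∀ {u v d d′} → d ≤ d′ → DistLe G u v d → DistLe G u v d′
  DistLe-mono d≤ (m , m≤ , W) = m , ≤-trans m≤ d≤ , W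

module Anchoring {n : ℕ} (G : Graph n) (a : ℕ) (anchor : Fin n → Fin n) where

  Anchored : Subset n → Fin n → Set
  Anchored A z = anchor z ∈ A × DistLe G z (anchor z) a

  sameAnchor : ∀ {A y z} → Anchored A y → Anchored A z → anchor y ≡ anchor z → DistLe G y z (a + a)
  sameAnchor (_ , y-near) (_ , z-near) same =
    DistLe-trans G y-near (subst (λ x → DistLe G x _ a) (≡-sym same) (DistLe-sym G z-near))

  dropAnchor : ∀ {A x} {zs : List (Fin n)} → All (Anchored A) zs → All (λ z → anchor z ≢ x) zs →
               All (Anchored (A - x)) zs
  dropAnchor anchored avoids =
    All.zipWith (λ { ((x∈A , near) , ≢x) → x∈p∧x≢y⇒x∈p-y x∈A ≢x , near }) (anchored , avoids)

  chain-diameter : ∀ {R : Fin n → Fin n → Set} {g} → (∀ {x y} → R x y → DistLe G x y g) →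
                   ∀ s A → ∣ A ∣ ≤ s → ∀ {u v m} (W : Walk R u v m) → All (Anchored A) (vertices W) →
                   ∃ λ d → d + g ≤ s * (a + a + g) × DistLe G u v d
  chain-diameter hop zero A |A|≤0 W anchored
    with ≤-trans (x∈p⇒∣p-x∣<∣p∣ (proj₁ (All-start W anchored))) |A|≤0
  ... | ()
  chain-diameter {R = R} {g} hop (suc s) A |A|≤ {u} {v} W anchored
    with lastVisit (λ z → anchor z ≟ anchor u) W
  ... | inj₁ none = ⊥-elim (All-start W none refl)
  ... | inj₂ lv = continue (suffix lv) (visits lv) (All-suffix lv anchored) (avoids lv)
    where
    c = a + a + g
    u-anchored = All-start W anchored
    |A-x|≤s : ∣ A - anchor u ∣ ≤ s
    |A-x|≤s = ≤-pred (≤-trans (x∈p⇒∣p-x∣<∣p∣ (proj₁ u-anchored)) |A|≤)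

    continue : ∀ {w m′} (W′ : Walk R w v m′) → anchor w ≡ anchor u → All (Anchored A) (vertices W′) →
               All (λ z → anchor z ≢ anchor u) (laterVertices W′) →
               ∃ λ d → d + g ≤ suc s * c × DistLe G u v d
    continue here same (v-anchored ∷ []) _ =
      a + a , m≤m+n c (s * c) , sameAnchor u-anchored v-anchored (≡-sym same)
    continue (step e W₃) same (w-anchored ∷ anchored₃) avoids₃
      with chain-diameter hop s (A - anchor u) |A-x|≤s W₃ (dropAnchor anchored₃ avoids₃)
    ... | d , d+g≤ , near = a + a + (g + d) , bound ,
          DistLe-trans G (sameAnchor u-anchored w-anchored (≡-sym same)) (DistLe-trans G (hop e) near)
      where
      open ≤-Reasoning
      bound : a + a + (g + d) + g ≤ suc s * c
      bound = begin
        a + a + (g + d) + g   ≡⟨ +-assoc (a + a) (g + d) g ⟩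
        a + a + (g + d + g)   ≡⟨ cong (a + a +_) (+-assoc g d g) ⟩
        a + a + (g + (d + g)) ≡⟨ +-assoc (a + a) g (d + g) ⟨
        c + (d + g)           ≤⟨ +-monoʳ-≤ c d+g≤ ⟩
        c + s * c             ∎

anchorOf : ∀ {n} {G : Graph n} {k a Z} → Narrow G k a Z → Fin n → Fin n
anchorOf {Z = Z} (_ , _ , near) z with z ∈? Z
... | yes z∈Z = proj₁ (near z z∈Z)
... | no _ = z

anchorOf-anchored : ∀ {n} {G : Graph n} {k a Z} (N : Narrow G k a Z) →
                    ∀ {z} → z ∈ Z → Anchoring.Anchored G a (anchorOf {G = G} {k} {a} N) (proj₁ N) z
anchorOf-anchored {Z = Z} (_ , _ , near) {z} z∈Z with z ∈? Z
... | yes z∈Z′ = proj₂ (near z z∈Z′)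
... | no z∉Z = ⊥-elim (z∉Z z∈Z)

fromList : ∀ {n} → List (Fin n) → Subset n
fromList [] = ⊥
fromList (x ∷ xs) = ⁅ x ⁆ ∪ fromList xs

∈-fromList⁺ : ∀ {n} {x : Fin n} {xs} → x ∈ₗ xs → x ∈ fromList xs
∈-fromList⁺ {x = x} (here refl) = x∈p∪q⁺ (inj₁ (x∈⁅x⁆ x))
∈-fromList⁺ (there x∈xs) = x∈p∪q⁺ (inj₂ (∈-fromList⁺ x∈xs))

∈-fromList⁻ : ∀ {n} {x : Fin n} xs → x ∈ fromList xs → x ∈ₗ xs
∈-fromList⁻ [] x∈⊥ = ⊥-elim (∉⊥ x∈⊥)
∈-fromList⁻ (y ∷ xs) x∈ with x∈p∪q⁻ ⁅ y ⁆ (fromList xs) x∈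
... | inj₁ x∈⁅y⁆ = here (x∈⁅y⁆⇒x≡y y x∈⁅y⁆)
... | inj₂ x∈xs = there (∈-fromList⁻ xs x∈xs)

module _ {n : ℕ} {G : Graph n} (F : Subgraph G) {u v m} (W : Walk (es F) u v m) where

  traced : Subgraph G
  traced = record
    { vs     = V
    ; es     = λ x y → x ∈ V × y ∈ V × es F x y
    ; es⊆E   = λ (_ , _ , e) → es⊆E F e
    ; es-l   = proj₁
    ; es-r   = proj₁ ∘ proj₂
    ; es-sym = λ (x∈ , y∈ , e) → y∈ , x∈ , es-sym F e
    }
    where V = fromList (vertices W)

  traced-connected : Connected traced
  traced-connected x y x∈ y∈
    with walkTo W (All.tabulate ∈-fromList⁺) (∈-fromList⁻ _ x∈)
       | walkTo W (All.tabulate ∈-fromList⁺) (∈-fromList⁻ _ y∈)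
  ... | m₁ , W₁ | m₂ , W₂ = m₁ + m₂ , reverse (es-sym traced) W₁ ++ʷ W₂

  traced-SubOf : (F′ : Subgraph G) → All (_∈ vs F′) (vertices W) →
                 (∀ {x y} → x ∈ₗ vertices W → y ∈ₗ vertices W → es F x y → es F′ x y) →
                 SubOf traced F′
  traced-SubOf F′ W⊆F′ edges =
    (λ x∈ → All.lookup W⊆F′ (∈-fromList⁻ _ x∈)) ,
    (λ (x∈ , y∈ , e) → edges (∈-fromList⁻ _ x∈) (∈-fromList⁻ _ y∈) e)

module _ {n : ℕ} {G : Graph n} {C : Set} {φ : Fin n → C} {Z : Subset n} {ℓ : ℕ}
         {H F : Subgraph G} (F⊆H : SubOf F H) (mono : Monochromatic φ F)
         (outside : ColDiamLe G φ (H minus Z) ℓ) where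

  avoiding-walk-DistLe : ∀ {x y m} (W : Walk (es F) x y m) → All (_∉ Z) (vertices W) → DistLe G x y ℓ
  avoiding-walk-DistLe here _ = DistLe-refl G
  avoiding-walk-DistLe W@(step e _) W∉Z =
    outside (traced F W) (traced-SubOf F W (H minus Z) W⊆H−Z edges) (traced-connected F W) traced-mono
            _ _ (∈-fromList⁺ (start∈vertices W)) (∈-fromList⁺ (end∈vertices W))
    where
    W⊆F : All (_∈ vs F) (vertices W)
    W⊆F = All-vertices (es-r F) (es-l F e) W
    W⊆H−Z : All (_∈ vs H ∩ ∁ Z) (vertices W)
    W⊆H−Z = All.zipWith (λ (x∈F , x∉Z) → x∈p∩q⁺ (proj₁ F⊆H x∈F , x∉p⇒x∈∁p x∉Z)) (W⊆F , W∉Z)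
    edges : ∀ {x y} → x ∈ₗ vertices W → y ∈ₗ vertices W → es F x y → es (H minus Z) x y
    edges x∈ y∈ e = proj₂ F⊆H e , All.lookup W∉Z x∈ , All.lookup W∉Z y∈
    traced-mono : Monochromatic φ (traced F W)
    traced-mono x y x∈ y∈ =
      mono x y (All.lookup W⊆F (∈-fromList⁻ _ x∈)) (All.lookup W⊆F (∈-fromList⁻ _ y∈))

module WalkSkeleton {n : ℕ} (G : Graph n) {R : Fin n → Fin n → Set}
         (R⇒Adj : ∀ {x y} → R x y → Adj G x y) (Z : Subset n) (ℓ : ℕ)
         (avoiding : ∀ {x y m} (W : Walk R x y m) → All (_∉ Z) (vertices W) → DistLe G x y ℓ) where

  data Entry (z : Fin n) : Fin n → Set where
    arrived : Entry z z
    via     : ∀ {u y m} (W : Walk R u y m) → All (_∉ Z) (vertices W) → R y z → Entry z u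

  Entry-extend : ∀ {z u w} → u ∉ Z → R u w → Entry z w → Entry z u
  Entry-extend u∉Z e arrived = via here (u∉Z ∷ []) e
  Entry-extend u∉Z e (via W W∉Z e′) = via (step e W) (u∉Z ∷ W∉Z) e′

  Entry-DistLe : ∀ {z u} → Entry z u → DistLe G u z (1 + ℓ)
  Entry-DistLe arrived = DistLe-refl G
  Entry-DistLe (via W W∉Z e) =
    DistLe-mono G (≤-reflexive (+-comm ℓ 1)) (DistLe-trans G (avoiding W W∉Z) (Adj⇒DistLe G (R⇒Adj e)))

  Hop : Fin n → Fin n → Set
  Hop x y = DistLe G x y (2 + ℓ)

  record Skeleton (u v : Fin n) : Set where
    field
      {first last} : Fin n
      {hops}       : ℕ
      entry        : Entry first u
      chain        : Walk Hop first last hops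
      chain⊆Z      : All (_∈ Z) (vertices chain)
      exit         : DistLe G last v (1 + ℓ)

  open Skeleton

  AvoidingWalk : Fin n → Fin n → Set
  AvoidingWalk u v = ∃ λ m → Σ (Walk R u v m) λ W → All (_∉ Z) (vertices W)

  skeleton : ∀ {u v m} → Walk R u v m → AvoidingWalk u v ⊎ Skeleton u v
  skeleton (here {v}) with v ∈? Z
  ... | yes v∈Z = inj₂ record { entry = arrived ; chain = here ; chain⊆Z = v∈Z ∷ [] ; exit = DistLe-refl G }
  ... | no v∉Z = inj₁ (0 , here , v∉Z ∷ [])
  skeleton (step {u} e W) with u ∈? Z | skeleton W
  ... | no u∉Z | inj₁ (_ , Q , Q∉Z) = inj₁ (_ , step e Q , u∉Z ∷ Q∉Z)
  ... | yes u∈Z | inj₁ (_ , Q , Q∉Z) = inj₂ record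
    { entry = arrived ; chain = here ; chain⊆Z = u∈Z ∷ []
    ; exit = DistLe-trans G (Adj⇒DistLe G (R⇒Adj e)) (avoiding Q Q∉Z) }
  ... | no u∉Z | inj₂ sk = inj₂ record
    { entry = Entry-extend u∉Z e (entry sk) ; chain = chain sk ; chain⊆Z = chain⊆Z sk ; exit = exit sk }
  ... | yes u∈Z | inj₂ sk = inj₂ record
    { entry = arrived
    ; chain = step (DistLe-trans G (Adj⇒DistLe G (R⇒Adj e)) (Entry-DistLe (entry sk))) (chain sk)
    ; chain⊆Z = u∈Z ∷ chain⊆Z sk ; exit = exit sk }

module _ {n : ℕ} {G : Graph n} {k a : ℕ} {Z : Subset n} (N : Narrow G k a Z) where

  open Anchoring G a (anchorOf {G = G} {k} {a} N)

  private
    D = proj₁ N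
    |D|≤k = proj₁ (proj₂ N)

  narrow-induced-GDiamLe : (F : Subgraph G) → InInduced F Z → Connected F →
                           GDiamLe G F (k * (a + a + 1) ∸ 1)
  narrow-induced-GDiamLe F F⊆Z F-connected u v u∈F v∈F with F-connected u v u∈F v∈F
  ... | _ , W with chain-diameter (λ e → Adj⇒DistLe G (es⊆E F e)) k D |D|≤k W
                     (All.map (anchorOf-anchored N ∘ F⊆Z) (All-vertices (es-r F) u∈F W))
  ... | d , d+1≤ , near = DistLe-mono G (m+n≤o⇒m≤o∸n d d+1≤) near

  narrow-ColDiamLe : ∀ {C : Set} (H : Subgraph G) (φ : Fin n → C) (ℓ : ℕ) →
                     ColDiamLe G φ (H minus Z) ℓ → ColDiamLe G φ H (k * (a + a + (2 + ℓ)) + ℓ)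
  narrow-ColDiamLe H φ ℓ outside F F⊆H F-connected F-mono u v u∈F v∈F =
    walk-DistLe (proj₂ (F-connected u v u∈F v∈F))
    where
    avoiding : ∀ {x y m} (W : Walk (es F) x y m) → All (_∉ Z) (vertices W) → DistLe G x y ℓ
    avoiding = avoiding-walk-DistLe {φ = φ} {Z = Z} {H = H} {F = F} F⊆H F-mono outside
    open WalkSkeleton G (es⊆E F) Z ℓ avoiding
    open Skeleton

    walk-DistLe : ∀ {m} → Walk (es F) u v m → DistLe G u v (k * (a + a + (2 + ℓ)) + ℓ)
    walk-DistLe W with skeleton W
    ... | inj₁ (_ , Q , Q∉Z) = DistLe-mono G (m≤n+m ℓ _) (avoiding Q Q∉Z)
    ... | inj₂ sk
      with chain-diameter (λ hop → hop) k D |D|≤k (chain sk) (All.map (anchorOf-anchored N) (chain⊆Z sk))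
    ... | d , d+g≤ , near =
      DistLe-mono G bound (DistLe-trans G (Entry-DistLe (entry sk)) (DistLe-trans G near (exit sk)))
      where
      open ≤-Reasoning
      rearrange : ∀ x y → 1 + x + (y + (1 + x)) ≡ y + (2 + x) + x
      rearrange = solve-∀
      bound : 1 + ℓ + (d + (1 + ℓ)) ≤ k * (a + a + (2 + ℓ)) + ℓ
      bound = begin
        1 + ℓ + (d + (1 + ℓ))     ≡⟨ rearrange ℓ d ⟩
        d + (2 + ℓ) + ℓ           ≤⟨ +-monoˡ-≤ ℓ d+g≤ ⟩
        k * (a + a + (2 + ℓ)) + ℓ ∎

ColDiamLe-mono : ∀ {n} {G : Graph n} {C : Set} {φ : Fin n → C} {F : Subgraph G} {d d′} →
                 d ≤ d′ → ColDiamLe G φ F d → ColDiamLe G φ F d′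
ColDiamLe-mono {G = G} d≤d′ diam F′ F′⊆F connected mono u v u∈ v∈ =
  DistLe-mono G d≤d′ (diam F′ F′⊆F connected mono u v u∈ v∈)

induced-bound-≡ : ∀ k a → k * (a + a + 1) ≡ 2 * a * k + k
induced-bound-≡ = solve-∀

colouring-bound : ∀ k a ℓ .{{_ : NonZero k}} → k * (a + a + (2 + ℓ)) + ℓ ≤ k * (2 * a + 2 * ℓ + 3)
colouring-bound k a ℓ = begin
  k * (a + a + (2 + ℓ)) + ℓ           ≤⟨ +-monoʳ-≤ _ (≤-trans (n≤1+n ℓ) (m≤n*m (1 + ℓ) k)) ⟩
  k * (a + a + (2 + ℓ)) + k * (1 + ℓ) ≡⟨ sum-≡ k a ℓ ⟩
  k * (2 * a + 2 * ℓ + 3)             ∎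
  where
  open ≤-Reasoning
  sum-≡ : ∀ k a ℓ → k * (a + a + (2 + ℓ)) + k * (1 + ℓ) ≡ k * (2 * a + 2 * ℓ + 3)
  sum-≡ = solve-∀

mainTheorem9 : ∀ {n} (G : Graph n) (k a : ℕ) → 1 ≤ k → (Z : Subset n) → Narrow G k a Z →
    ((F : Subgraph G) → InInduced F Z → Connected F → GDiamLe G F (2 * a * k + k ∸ 1))
    × (∀ {C : Set} (H : Subgraph G) (φ : _ → C) (ℓ : ℕ) → Z ⊆ vs H →
    ColDiamLe G φ (H minus Z) ℓ → ColDiamLe G φ H (k * (2 * a + 2 * ℓ + 3)))
mainTheorem9 G k@(suc _) a _ Z N =
  (λ F F⊆Z connected →
     subst (GDiamLe G F) (cong (_∸ 1) (induced-bound-≡ k a)) (narrow-induced-GDiamLe N F F⊆Z connected)) ,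
  (λ H φ ℓ _ outside →
     ColDiamLe-mono {G = G} {φ = φ} {F = H} (colouring-bound k a ℓ) (narrow-ColDiamLe N H φ ℓ outside))
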